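{- Let $(M_n)_{n\ge1}$, $M_n=(f_n(m,k))_{1\le m,k\le 2n}$, be the Delta sequence. Then each $M_n$ is symmetric with respect to its counter-diagonal: $$f_n(m,k)=f_n(2n+1-k,\,2n+1-m)\qquad(1\le m,k\le 2n).$$
   Context: Delta sequence. For $n\ge1$, $M_n=(f_n(m,k))_{1\le m,k\le 2n}$ is a $2n\times 2n$ matrix; by convention $f_n(m,k)=0$ if $(m,k)\notin[1,2n]^2$. Write $f_n(m,\bullet)=\sum_{k=1}^{2n}f_n(m,k)$ and $f_n(\bullet,k)=\sum_{m=1}^{2n}f_n(m,k)$. Let $L_n^{(1)}=\{(m,k):2\le k+1\le m\le 2n-2\}$ and $U_n^{(1)}=\{(m,k):2\le m+1\le k\le 2n-2\}$. The Delta sequence is the unique sequence $(M_n)_{n\ge1}$ of matrices with nonnegative integer entries such that $M_1=\begin{pmatrix}0&0\\1&0\end{pmatrix}$ and, for every $n\ge2$: (a) $f_n(m,m)=0$ for all $m$; (b) $f_n(m+2,k)-2f_n(m+1,k)+f_n(m,k)+2f_{n-1}(m,k)=0$ for $(m,k)\in L_n^{(1)}$; (c) $f_n(m,k+2)-2f_n(m,k+1)+f_n(m,k)+2f_{n-1}(m,k)=0$ for $(m,k)\in U_n^{(1)}$; (d) column $2n$ of $M_n$ is zero, and column $2n-1$ is $(f_{n-1}(1,\bullet),\dots,f_{n-1}(2n-2,\bullet),0,0)$ read top to bottom; (e) row $2n$ of $M_n$ is $(f_{n-1}(1,\bullet),\dots,f_{n-1}(2n-2,\bullet),0,0)$ read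 left to right, and row $2n-1$ is $(f_{n-1}(1,\bullet)+f_{n-1}(\bullet,1),\dots,f_{n-1}(2n-2,\bullet)+f_{n-1}(\bullet,2n-2),0,0)$. (These conditions determine the sequence uniquely.) -}

module Defs where

open import Data.Nat using (ℕ; zero; suc; _+_; _*_; _∸_; _≤_; _<_)
open import Data.Sum using (_⊎_)
open import Relation.Binary.PropositionalEquality using (_≡_)

-- A sequence of matrices (M_n)_{n ≥ 1} is encoded as a function
-- f : ℕ → ℕ → ℕ → ℕ with  f n m k = f_n(m,k)  (1-based indices);
-- the value at n = 0 is irrelevant.

sumTo : (ℕ → ℕ) → ℕ → ℕ
sumTo g zero    = 0
sumTo g (suc N) = sumTo g N + g (suc N)

rowSum : (ℕ → ℕ → ℕ → ℕ) → ℕ → ℕ → ℕ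
rowSum f n m = sumTo (λ k → f n m k) (2 * n)

colSum : (ℕ → ℕ → ℕ → ℕ) → ℕ → ℕ → ℕ
colSum f n k = sumTo (λ m → f n m k) (2 * n)

record IsDelta (f : ℕ → ℕ → ℕ → ℕ) : Set where
  field
    outside : ∀ n m k → 1 ≤ n →
              (m ≡ 0 ⊎ 2 * n < m ⊎ k ≡ 0 ⊎ 2 * n < k) → f n m k ≡ 0
    init11 : f 1 1 1 ≡ 0
    init12 : f 1 1 2 ≡ 0
    init21 : f 1 2 1 ≡ 1
    init22 : f 1 2 2 ≡ 0
    -- (a)
    diag : ∀ n → 2 ≤ n → ∀ m → 1 ≤ m → m ≤ 2 * n → f n m m ≡ 0
    -- (b)  (m,k) ∈ L_n^(1) : 2 ≤ k+1 ≤ m ≤ 2n-2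
    lower : ∀ n → 2 ≤ n → ∀ m k → 1 ≤ k → k + 1 ≤ m → m ≤ 2 * n ∸ 2 →
            f n (m + 2) k + f n m k + 2 * f (n ∸ 1) m k ≡ 2 * f n (m + 1) k
    -- (c)  (m,k) ∈ U_n^(1) : 2 ≤ m+1 ≤ k ≤ 2n-2
    upper : ∀ n → 2 ≤ n → ∀ m k → 1 ≤ m → m + 1 ≤ k → k ≤ 2 * n ∸ 2 →
            f n m (k + 2) + f n m k + 2 * f (n ∸ 1) m k ≡ 2 * f n m (k + 1)
    -- (d)
    col2n   : ∀ n → 2 ≤ n → ∀ m → 1 ≤ m → m ≤ 2 * n → f n m (2 * n) ≡ 0
    col2n-1 : ∀ n → 2 ≤ n → ∀ m → 1 ≤ m → m ≤ 2 * n ∸ 2 →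
              f n m (2 * n ∸ 1) ≡ rowSum f (n ∸ 1) m
    col2n-1a : ∀ n → 2 ≤ n → f n (2 * n ∸ 1) (2 * n ∸ 1) ≡ 0
    col2n-1b : ∀ n → 2 ≤ n → f n (2 * n) (2 * n ∸ 1) ≡ 0
    -- (e)
    row2n   : ∀ n → 2 ≤ n → ∀ k → 1 ≤ k → k ≤ 2 * n ∸ 2 →
              f n (2 * n) k ≡ rowSum f (n ∸ 1) k
    row2na  : ∀ n → 2 ≤ n → f n (2 * n) (2 * n ∸ 1) ≡ 0
    row2nb  : ∀ n → 2 ≤ n → f n (2 * n) (2 * n) ≡ 0
    row2n-1 : ∀ n → 2 ≤ n → ∀ k → 1 ≤ k → k ≤ 2 * n ∸ 2 →
              f n (2 * n ∸ 1) k ≡ rowSum f (n ∸ 1) k + colSum f (n ∸ 1) k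
    row2n-1a : ∀ n → 2 ≤ n → f n (2 * n ∸ 1) (2 * n ∸ 1) ≡ 0
    row2n-1b : ∀ n → 2 ≤ n → f n (2 * n ∸ 1) (2 * n) ≡ 0

module Submission where

-- Conditions (b) and (c) say that columns below the diagonal and rows above
-- it solve the second-order recurrence  x(j+2) + x(j) + 2 s(j) = 2 x(j+1)
-- (Rec), with source s taken from the previous matrix.  Such a solution is
-- determined by its two last values (rec-unique), and (d), (e) provide them.
-- The symmetry is proved by induction on n together with six companion facts
-- (the record Invariant): row 1 and column 1, the lower triangle as the
-- transpose of the upper one plus a copy of column 1, a column recurrence in
-- the upper triangle, the recurrence of row sums, and column sums as shifted
-- row sums.  At level n each of them follows by exhibiting both sides as
-- solutions of one recurrence with equal top values, using the facts at the
-- previous level.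

open import Defs
open import Data.Nat using (ℕ; zero; suc; _+_; _*_; _∸_; _≤_; _<_; z≤n; s≤s; _≤?_)
open import Data.Nat.Properties
open import Data.Nat.Tactic.RingSolver using (solve-∀)
open import Data.Product using (_×_; _,_; proj₁)
open import Data.Sum using (inj₁; inj₂)
open import Data.Empty using (⊥-elim)
open import Relation.Binary.PropositionalEquality
open import Relation.Nullary using (¬_; yes; no)
open import Relation.Binary.Definitions using (tri<; tri≈; tri>)

∸-from-+ : ∀ {a b c} → a + b ≡ c → c ∸ a ≡ b
∸-from-+ {a} {b} refl = m+n∸m≡n a b

≤-from-+ : ∀ {a b} d → a + d ≡ b → a ≤ b
≤-from-+ {a} d refl = m≤m+n a d

reflect : ∀ {j d L} → j + d ≡ L → L + 1 ∸ j ≡ d + 1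
reflect {j} {d} refl = ∸-from-+ {j} (sym (+-assoc j d 1))

reflect-≥1 : ∀ {j d L} → j + d ≡ L → 1 ≤ L + 1 ∸ j
reflect-≥1 {d = d} e = subst (1 ≤_) (sym (reflect e)) (m≤n+m 1 d)

reflect-≤ : ∀ {j d L} → 1 ≤ j → j + d ≡ L → L + 1 ∸ j ≤ L
reflect-≤ {j} {d} {L} 1≤j e = subst (_≤ L) (sym (reflect e)) (subst (d + 1 ≤_) (trans (+-comm d j) e) (+-monoʳ-≤ d 1≤j))

reflect-gap : ∀ {i k a b u L} → i + a ≡ L → k + b ≡ L → k + 1 + u ≡ i → L + 1 ∸ i + 1 + u ≡ L + 1 ∸ k
reflect-gap {i} {k} {a} {b} {u} refl k+b≡L refl = begin
    k + 1 + u + a + 1 ∸ i + 1 + u  ≡⟨ cong (λ m → m + 1 + u) (reflect {i} {a} refl) ⟩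
    a + 1 + 1 + u                  ≡⟨ regroup₁ a u ⟩
    a + 1 + u + 1                  ≡⟨ cong (_+ 1) (sym b≡a+1+u) ⟩
    b + 1                          ≡⟨ sym (reflect k+b≡L) ⟩
    k + 1 + u + a + 1 ∸ k          ∎
  where
  open ≡-Reasoning
  regroup₁ : ∀ a u → a + 1 + 1 + u ≡ a + 1 + u + 1
  regroup₁ = solve-∀
  regroup₂ : ∀ k u a → k + 1 + u + a ≡ k + (a + 1 + u)
  regroup₂ = solve-∀
  b≡a+1+u : b ≡ a + 1 + u
  b≡a+1+u = +-cancelˡ-≡ k b (a + 1 + u) (trans k+b≡L (regroup₂ k u a))

reflect-shift : ∀ L j → L + 2 + 1 ∸ j ∸ 2 ≡ L + 1 ∸ j
reflect-shift L j = begin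
    L + 2 + 1 ∸ j ∸ 2    ≡⟨ ∸-+-assoc (L + 2 + 1) j 2 ⟩
    L + 2 + 1 ∸ (j + 2)  ≡⟨ cong (L + 2 + 1 ∸_) (+-comm j 2) ⟩
    L + 2 + 1 ∸ (2 + j)  ≡⟨ sym (∸-+-assoc (L + 2 + 1) 2 j) ⟩
    L + 2 + 1 ∸ 2 ∸ j    ≡⟨ cong (_∸ j) (∸-from-+ {2} (regroup L)) ⟩
    L + 1 ∸ j            ∎
  where
  open ≡-Reasoning
  regroup : ∀ L → 2 + (L + 1) ≡ L + 2 + 1
  regroup = solve-∀

+1∸2 : ∀ m → m + 1 ∸ 2 ≡ m ∸ 1
+1∸2 m = trans (sym (∸-+-assoc (m + 1) 1 1)) (cong (_∸ 1) (m+n∸n≡m m 1))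

≰-squeeze : ∀ {k P} → ¬ k ≤ P → k + 1 ≤ P + 2 → k ≡ P + 1
≰-squeeze {k} {P} k≰P k+1≤P+2 =
  ≤-antisym (+-cancelʳ-≤ 1 k (P + 1) (subst (k + 1 ≤_) (sym (+-assoc P 1 1)) k+1≤P+2))
            (subst (_≤ k) (+-comm 1 P) (≰⇒> k≰P))

+-assoc-≤ : ∀ r a b {c} → r + (a + b) ≤ c → r + a + b ≤ c
+-assoc-≤ r a b {c} = subst (_≤ c) (sym (+-assoc r a b))

complement-≤ : ∀ {c j d L} → c ≤ j → j + d ≡ L → c + d ≤ L
complement-≤ {d = d} c≤j refl = +-monoˡ-≤ d c≤j

-- The cancellation behind the superdiagonal identity of the Delta sequence:
-- from  a + b + 2c = 2x,  y + a + 2c = 2z  and  2z + g = w + y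
-- follows  2x + g = b + w.
superdiagonal-step : ∀ a b c x y z w g → a + b + 2 * c ≡ 2 * x → y + a + 2 * c ≡ 2 * z →
                     2 * z + g ≡ w + y → 2 * x + g ≡ b + w
superdiagonal-step a b c x y z w g e₁ e₂ e₃ = +-cancelʳ-≡ (a + 2 * c + y) (2 * x + g) (b + w) (begin
    2 * x + g + (a + 2 * c + y)  ≡⟨ cong (λ u → u + g + (a + 2 * c + y)) (sym e₁) ⟩
    a + b + 2 * c + g + (a + 2 * c + y)  ≡⟨ regroup₁ a b c g y ⟩
    b + a + 2 * c + g + (y + a + 2 * c)  ≡⟨ cong (b + a + 2 * c + g +_) e₂ ⟩
    b + a + 2 * c + g + 2 * z            ≡⟨ regroup₂ a b c g (2 * z) ⟩
    b + (2 * z + g) + (a + 2 * c)        ≡⟨ cong (λ u → b + u + (a + 2 * c)) e₃ ⟩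
    b + (w + y) + (a + 2 * c)            ≡⟨ regroup₃ a b c w y ⟩
    b + w + (a + 2 * c + y)              ∎)
  where
  open ≡-Reasoning
  regroup₁ : ∀ a b c g y → a + b + 2 * c + g + (a + 2 * c + y) ≡ b + a + 2 * c + g + (y + a + 2 * c)
  regroup₁ = solve-∀
  regroup₂ : ∀ a b c g z → b + a + 2 * c + g + z ≡ b + (z + g) + (a + 2 * c)
  regroup₂ = solve-∀
  regroup₃ : ∀ a b c w y → b + (w + y) + (a + 2 * c) ≡ b + w + (a + 2 * c + y)
  regroup₃ = solve-∀

-- The arithmetic of a 3 × 3 block around the diagonal (see near-diagonal).
block-identity : ∀ x g w b → 2 * x + g ≡ b + w →
                 (x + g + (w + 0) + 0) + (0 + b + x) + 2 * 0 ≡ 2 * (b + 0 + 0 + w)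
block-identity x g w b e = trans (regroup₁ x g w b) (trans (cong (λ u → u + w + b) e) (regroup₂ x g w b))
  where
  regroup₁ : ∀ x g w b → (x + g + (w + 0) + 0) + (0 + b + x) + 2 * 0 ≡ (2 * x + g) + w + b
  regroup₁ = solve-∀
  regroup₂ : ∀ x g w b → b + w + w + b ≡ 2 * (b + 0 + 0 + w)
  regroup₂ = solve-∀

descend : (Q : ℕ → Set) (a T : ℕ) → Q T →
          (∀ j → a ≤ j → j < T → Q (j + 1) → Q j) →
          ∀ j → a ≤ j → j ≤ T → Q j
descend Q a T top step j a≤j j≤T = go (T ∸ j) j (m+[n∸m]≡n j≤T) a≤j
  where
  go : ∀ d j → j + d ≡ T → a ≤ j → Q j
  go zero    j e _   = subst Q (trans (sym e) (+-identityʳ j)) top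
  go (suc d) j e a≤j =
    step j a≤j (≤-from-+ d (trans (sym (+-suc j d)) e))
         (go d (j + 1) (trans (+-assoc j 1 d) e) (≤-trans a≤j (m≤m+n j 1)))

sumTo-cong : ∀ (g h : ℕ → ℕ) N → (∀ j → 1 ≤ j → j ≤ N → g j ≡ h j) → sumTo g N ≡ sumTo h N
sumTo-cong g h zero    e = refl
sumTo-cong g h (suc N) e =
  cong₂ _+_ (sumTo-cong g h N (λ j 1≤j j≤N → e j 1≤j (m≤n⇒m≤1+n j≤N))) (e (suc N) (s≤s z≤n) ≤-refl)

sumTo-zero : ∀ (g : ℕ → ℕ) N → (∀ j → 1 ≤ j → j ≤ N → g j ≡ 0) → sumTo g N ≡ 0
sumTo-zero g N e = trans (sumTo-cong g (λ _ → 0) N e) (zeros N)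
  where
  zeros : ∀ N → sumTo (λ _ → 0) N ≡ 0
  zeros zero    = refl
  zeros (suc N) = trans (+-identityʳ _) (zeros N)

sumTo-+ : ∀ (g h : ℕ → ℕ) N → sumTo (λ j → g j + h j) N ≡ sumTo g N + sumTo h N
sumTo-+ g h zero    = refl
sumTo-+ g h (suc N) = trans (cong (_+ (g (suc N) + h (suc N))) (sumTo-+ g h N))
                            (+-exchange (sumTo g N) (sumTo h N) (g (suc N)) (h (suc N)))
  where
  +-exchange : ∀ a b c d → a + b + (c + d) ≡ a + c + (b + d)
  +-exchange = solve-∀

sumTo-split : ∀ (g : ℕ → ℕ) a b → sumTo g (a + b) ≡ sumTo g a + sumTo (λ i → g (a + i)) b
sumTo-split g a zero    = trans (cong (sumTo g) (+-identityʳ a)) (sym (+-identityʳ _))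
sumTo-split g a (suc b) = trans (cong (λ c → sumTo g c) (+-suc a b))
  (trans (cong (_+ g (suc (a + b))) (sumTo-split g a b))
         (trans (+-assoc (sumTo g a) _ _) (cong (λ c → sumTo g a + (sumTo (λ i → g (a + i)) b + g c)) (sym (+-suc a b)))))

sumTo-last-two : ∀ (g : ℕ → ℕ) P → sumTo g (P + 2) ≡ sumTo g P + g (P + 1) + g (P + 2)
sumTo-last-two g P = trans (cong (sumTo g) (+-comm P 2))
  (cong₂ (λ a b → sumTo g P + g a + g b) (+-comm 1 P) (+-comm 2 P))

sumTo-first : ∀ (g : ℕ → ℕ) N → sumTo g (suc N) ≡ g 1 + sumTo (λ j → g (suc j)) N
sumTo-first g zero    = +-comm 0 (g 1)
sumTo-first g (suc N) = trans (cong (_+ g (suc (suc N))) (sumTo-first g N)) (+-assoc (g 1) _ _)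

sumTo-last : ∀ (g : ℕ → ℕ) k → 1 ≤ k → sumTo g k ≡ sumTo g (k ∸ 1) + g k
sumTo-last g (suc k) _ = refl

sumTo-around : ∀ (g : ℕ → ℕ) k b → 1 ≤ k →
               sumTo g (k + 2 + b) ≡ sumTo g (k ∸ 1) + (g k + g (k + 1) + g (k + 2)) + sumTo (λ i → g (k + 2 + i)) b
sumTo-around g (suc k₀) b _ = begin
    sumTo g (suc k₀ + 2 + b)
  ≡⟨ sumTo-split g (suc k₀ + 2) b ⟩
    sumTo g (suc k₀ + 2) + tail
  ≡⟨ cong (λ m → sumTo g m + tail) (at₀ k₀) ⟩
    sumTo g (k₀ + 3) + tail
  ≡⟨ cong (_+ tail) (sumTo-split g k₀ 3) ⟩
    sumTo g k₀ + (0 + g (k₀ + 1) + g (k₀ + 2) + g (k₀ + 3)) + tail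
  ≡⟨ cong (λ u → sumTo g k₀ + u + tail)
          (cong₃ (λ a b c → 0 + g a + g b + g c) (at₁ k₀) (at₂ k₀) (at₃ k₀)) ⟩
    sumTo g k₀ + (g (suc k₀) + g (suc k₀ + 1) + g (suc k₀ + 2)) + tail
  ∎
  where
  open ≡-Reasoning
  tail : ℕ
  tail = sumTo (λ i → g (suc k₀ + 2 + i)) b
  cong₃ : ∀ (h : ℕ → ℕ → ℕ → ℕ) {a a′ b b′ c c′} → a ≡ a′ → b ≡ b′ → c ≡ c′ → h a b c ≡ h a′ b′ c′
  cong₃ h refl refl refl = refl
  at₀ : ∀ k₀ → suc k₀ + 2 ≡ k₀ + 3
  at₀ = solve-∀
  at₁ : ∀ k₀ → k₀ + 1 ≡ suc k₀
  at₁ = solve-∀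
  at₂ : ∀ k₀ → k₀ + 2 ≡ suc k₀ + 1
  at₂ = solve-∀
  at₃ : ∀ k₀ → k₀ + 3 ≡ suc k₀ + 2
  at₃ = solve-∀

sumTo-reverse : ∀ (g : ℕ → ℕ) N → sumTo (λ j → g (N + 1 ∸ j)) N ≡ sumTo g N
sumTo-reverse g N = trans (sumTo-cong _ _ N (λ j _ _ → cong (λ c → g (c ∸ j)) (+-comm N 1))) (reverse g N)
  where
  suc-∸ : ∀ {j m} → j ≤ m → suc m ∸ j ≡ suc (m ∸ j)
  suc-∸ {zero}                _         = refl
  suc-∸ {suc j} {suc m} (s≤s j≤m) = suc-∸ j≤m
  reverse : ∀ (g : ℕ → ℕ) N → sumTo (λ j → g (suc N ∸ j)) N ≡ sumTo g N
  reverse g zero    = refl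
  reverse g (suc N) = begin
      sumTo (λ j → g (suc (suc N) ∸ j)) N + g (suc (suc N) ∸ suc N)
    ≡⟨ cong₂ _+_ (sumTo-cong _ _ N (λ j _ j≤N → cong g (suc-∸ (m≤n⇒m≤1+n j≤N))))
                 (cong g (suc-∸ {N} {N} ≤-refl)) ⟩
      sumTo (λ j → g (suc (suc N ∸ j))) N + g (suc (N ∸ N))
    ≡⟨ cong₂ _+_ (reverse (λ i → g (suc i)) N) (cong (λ c → g (suc c)) (n∸n≡0 N)) ⟩
      sumTo (λ j → g (suc j)) N + g 1
    ≡⟨ +-comm _ (g 1) ⟩
      g 1 + sumTo (λ j → g (suc j)) N
    ≡⟨ sym (sumTo-first g N) ⟩
      sumTo g (suc N)
    ∎
    where open ≡-Reasoning

-- x satisfies the recurrence of the Delta sequence at j with source s: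
-- the second difference of x at j equals -2 s(j).
Rec : (ℕ → ℕ) → (ℕ → ℕ) → ℕ → Set
Rec x s j = x (j + 2) + x j + 2 * s j ≡ 2 * x (j + 1)

rec-solve-down : ∀ {x y s t : ℕ → ℕ} j → Rec x s j → Rec y t j →
                 x (j + 1) ≡ y (j + 1) → x (j + 2) ≡ y (j + 2) → s j ≡ t j → x j ≡ y j
rec-solve-down {x} {y} {s} {t} j rx ry e₁ e₂ eₛ =
  +-cancelˡ-≡ (x (j + 2)) (x j) (y j) (+-cancelʳ-≡ (2 * s j) _ _ (begin
    x (j + 2) + x j + 2 * s j  ≡⟨ rx ⟩
    2 * x (j + 1)              ≡⟨ cong (2 *_) e₁ ⟩
    2 * y (j + 1)              ≡⟨ sym ry ⟩
    y (j + 2) + y j + 2 * t j  ≡⟨ cong₂ (λ u v → u + y j + 2 * v) (sym e₂) (sym eₛ) ⟩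
    x (j + 2) + y j + 2 * s j  ∎))
  where open ≡-Reasoning

-- Backward uniqueness: on [a, T + 2] a solution is determined by its two
-- top values (the value at T + 1 only matters when it lies in the interval).
rec-unique : ∀ {x y s t : ℕ → ℕ} a T →
             (a ≤ T + 1 → x (T + 1) ≡ y (T + 1)) → x (T + 2) ≡ y (T + 2) →
             (∀ j → a ≤ j → j ≤ T → Rec x s j) → (∀ j → a ≤ j → j ≤ T → Rec y t j) →
             (∀ j → a ≤ j → j ≤ T → s j ≡ t j) →
             ∀ j → a ≤ j → j ≤ T + 2 → x j ≡ y j
rec-unique {x} {y} {s} {t} a T top₁ top₂ rx ry eₛ j a≤j j≤T+2 with m≤n⇒m<n∨m≡n j≤T+2
... | inj₂ refl = top₂
... | inj₁ j<T+2 = proj₁ (descend Q a (T + 1) topQ stepQ j a≤j j≤T+1)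
  where
  Q : ℕ → Set
  Q i = x i ≡ y i × x (i + 1) ≡ y (i + 1)
  j≤T+1 : j ≤ T + 1
  j≤T+1 = ≤-pred (subst (suc j ≤_) (+-suc T 1) j<T+2)
  topQ : Q (T + 1)
  topQ = top₁ (≤-trans a≤j j≤T+1) , subst (λ i → x i ≡ y i) (sym (+-assoc T 1 1)) top₂
  stepQ : ∀ i → a ≤ i → i < T + 1 → Q (i + 1) → Q i
  stepQ i a≤i i<T+1 (e₁ , e₂) =
    rec-solve-down {x = x} {y = y} {s = s} {t = t} i (rx i a≤i i≤T) (ry i a≤i i≤T) e₁
                   (subst (λ k → x k ≡ y k) (+-assoc i 1 1) e₂) (eₛ i a≤i i≤T)
    , e₁
    where
    i≤T : i ≤ T
    i≤T = ≤-pred (subst (suc i ≤_) (+-comm T 1) i<T+1)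

rec-transport : ∀ {x y s t : ℕ → ℕ} j → x j ≡ y j → x (j + 1) ≡ y (j + 1) →
                x (j + 2) ≡ y (j + 2) → s j ≡ t j → Rec x s j → Rec y t j
rec-transport j e₀ e₁ e₂ eₛ r =
  trans (cong₂ _+_ (cong₂ _+_ (sym e₂) (sym e₀)) (cong (2 *_) (sym eₛ)))
        (trans r (cong (2 *_) e₁))

rec-+ : ∀ {x y s t : ℕ → ℕ} j → Rec x s j → Rec y t j →
        Rec (λ c → x c + y c) (λ c → s c + t c) j
rec-+ {x} {y} {s} {t} j rx ry =
  trans (shuffle (x (j + 2)) (x j) (s j) (y (j + 2)) (y j) (t j))
        (trans (cong₂ _+_ rx ry) (sym (*-distribˡ-+ 2 (x (j + 1)) (y (j + 1)))))
  where
  shuffle : ∀ a b c d e g → (a + d) + (b + e) + 2 * (c + g) ≡ (a + b + 2 * c) + (d + e + 2 * g)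
  shuffle = solve-∀

rec-2* : ∀ {x s : ℕ → ℕ} j → Rec x s j → Rec (λ c → 2 * x c) (λ c → 2 * s c) j
rec-2* {x} {s} j r = trans (double (x (j + 2)) (x j) (s j)) (cong (2 *_) r)
  where
  double : ∀ a b c → 2 * a + 2 * b + 2 * (2 * c) ≡ 2 * (a + b + 2 * c)
  double = solve-∀

rec-reflect : ∀ {g s t : ℕ → ℕ} L i j → j + i + 1 ≡ L → t j ≡ s i →
              Rec g s i → Rec (λ c → g (L + 1 ∸ c)) t j
rec-reflect {g} {s} {t} .(j + i + 1) i j refl eₛ r = begin
    g (L + 1 ∸ (j + 2)) + g (L + 1 ∸ j) + 2 * t j  ≡⟨ cong₂ (λ u v → g u + g v + 2 * t j) at₂ at₀ ⟩
    g i + g (i + 2) + 2 * t j                      ≡⟨ cong (λ u → g i + g (i + 2) + 2 * u) eₛ ⟩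
    g i + g (i + 2) + 2 * s i                      ≡⟨ cong (_+ 2 * s i) (+-comm (g i) (g (i + 2))) ⟩
    g (i + 2) + g i + 2 * s i                      ≡⟨ r ⟩
    2 * g (i + 1)                                  ≡⟨ cong (λ u → 2 * g u) (sym at₁) ⟩
    2 * g (L + 1 ∸ (j + 1))                        ∎
  where
  open ≡-Reasoning
  L : ℕ
  L = j + i + 1
  sum₀ : ∀ j i → j + (i + 2) ≡ j + i + 1 + 1
  sum₀ = solve-∀
  sum₁ : ∀ j i → j + 1 + (i + 1) ≡ j + i + 1 + 1
  sum₁ = solve-∀
  sum₂ : ∀ j i → j + 2 + i ≡ j + i + 1 + 1
  sum₂ = solve-∀
  at₀ : L + 1 ∸ j ≡ i + 2
  at₀ = ∸-from-+ {j} (sum₀ j i)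
  at₁ : L + 1 ∸ (j + 1) ≡ i + 1
  at₁ = ∸-from-+ {j + 1} (sum₁ j i)
  at₂ : L + 1 ∸ (j + 2) ≡ i
  at₂ = ∸-from-+ {j + 2} (sum₂ j i)

rec-sumTo : ∀ (x s : ℕ → ℕ → ℕ) N j →
            (∀ c → 1 ≤ c → c ≤ N → Rec (λ r → x r c) (λ r → s r c) j) →
            Rec (λ r → sumTo (x r) N) (λ r → sumTo (s r) N) j
rec-sumTo x s zero    j h = refl
rec-sumTo x s (suc N) j h =
  rec-+ {x = λ r → sumTo (x r) N} {y = λ r → x r (suc N)}
        {s = λ r → sumTo (s r) N} {t = λ r → s r (suc N)} j
        (rec-sumTo x s N j (λ c 1≤c c≤N → h c 1≤c (m≤n⇒m≤1+n c≤N))) (h (suc N) (s≤s z≤n) ≤-refl)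

rec-translate : ∀ {g s : ℕ → ℕ} c i → Rec g s (i + c) →
                Rec (λ j → g (j + c)) (λ j → s (j + c)) i
rec-translate {g} {s} c i =
  subst₂ (λ u v → g u + g (i + c) + 2 * s (i + c) ≡ 2 * g v) (swap 2) (swap 1)
  where
  swap : ∀ a → i + c + a ≡ i + a + c
  swap a = trans (+-assoc i c a) (trans (cong (i +_) (+-comm c a)) (sym (+-assoc i a c)))

rec-shift : ∀ {g s : ℕ → ℕ} d i → d ≤ i → Rec g s (i ∸ d) →
            Rec (λ j → g (j ∸ d)) (λ j → s (j ∸ d)) i
rec-shift {g} {s} d i d≤i =
  subst₂ (λ u v → g u + g (i ∸ d) + 2 * s (i ∸ d) ≡ 2 * g v)
         (sym (+-∸-comm 2 d≤i)) (sym (+-∸-comm 1 d≤i))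

module Delta (f : ℕ → ℕ → ℕ → ℕ) (D : IsDelta f) where
  open IsDelta D

  R C : ℕ → ℕ → ℕ
  R = rowSum f
  C = colSum f

  -- The invariant carried from level ℓ - 1 to level ℓ, for a matrix of
  -- size L (= 2ℓ).
  record Invariant (ℓ L : ℕ) : Set where
    field
      row1-zero : ∀ k → f ℓ 1 k ≡ 0
      col1-rowsums : ∀ j → 2 ≤ j → j ≤ L → f ℓ j 1 ≡ R (ℓ ∸ 1) (L + 1 ∸ j)
      lower-transpose : ∀ k i → 1 ≤ k → k + 1 ≤ i → i ≤ L →
                        f ℓ i k ≡ f ℓ k i + f ℓ (i ∸ k + 1) 1
      upper-col-rec : ∀ r c → 1 ≤ r → r + 3 ≤ c → c ≤ L →
                      Rec (λ m → f ℓ m c) (λ m → f (ℓ ∸ 1) m (c ∸ 2)) r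
      symmetric : ∀ i k → 1 ≤ i → i ≤ L → 1 ≤ k → k ≤ L →
                  f ℓ i k ≡ f ℓ (L + 1 ∸ k) (L + 1 ∸ i)
      rowsum-rec : ∀ k → 1 ≤ k → k + 1 ≤ L → Rec (R ℓ) (R (ℓ ∸ 1)) k
      colsum-shift : ∀ k → 1 ≤ k → k ≤ L → C ℓ k ≡ R ℓ (k + 1)

  module Level (p : ℕ) (1≤p : 1 ≤ p) where
    n P : ℕ
    n = suc p
    P = 2 * p

    2≤n : 2 ≤ n
    2≤n = s≤s 1≤p
    size : 2 * n ≡ P + 2
    size = trans (*-suc 2 p) (+-comm 2 P)
    size-1 : 2 * n ∸ 1 ≡ P + 1
    size-1 = trans (cong (_∸ 1) size) (+-∸-assoc P {2} {1} (s≤s z≤n))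
    size-2 : 2 * n ∸ 2 ≡ P
    size-2 = trans (cong (_∸ 2) size) (m+n∸n≡m P 2)

    diagonal : ∀ j → 1 ≤ j → j ≤ P + 2 → f n j j ≡ 0
    diagonal j 1≤j j≤ = diag n 2≤n j 1≤j (subst (j ≤_) (sym size) j≤)
    -- (b), a recurrence down each column
    lower-rec : ∀ i k → 1 ≤ k → k + 1 ≤ i → i ≤ P → Rec (λ m → f n m k) (λ m → f p m k) i
    lower-rec i k 1≤k k<i i≤P = lower n 2≤n i k 1≤k k<i (subst (i ≤_) (sym size-2) i≤P)
    -- (c), a recurrence along each row
    upper-rec : ∀ i k → 1 ≤ i → i + 1 ≤ k → k ≤ P → Rec (f n i) (f p i) k
    upper-rec i k 1≤i i<k k≤P = upper n 2≤n i k 1≤i i<k (subst (k ≤_) (sym size-2) k≤P)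
    last-col : ∀ r → 1 ≤ r → r ≤ P + 2 → f n r (P + 2) ≡ 0
    last-col r 1≤r r≤ = subst (λ c → f n r c ≡ 0) size (col2n n 2≤n r 1≤r (subst (r ≤_) (sym size) r≤))
    penult-col : ∀ r → 1 ≤ r → r ≤ P → f n r (P + 1) ≡ R p r
    penult-col r 1≤r r≤P =
      subst (λ c → f n r c ≡ R p r) size-1 (col2n-1 n 2≤n r 1≤r (subst (r ≤_) (sym size-2) r≤P))
    penult-col-P+1 : f n (P + 1) (P + 1) ≡ 0
    penult-col-P+1 = subst (λ c → f n c c ≡ 0) size-1 (col2n-1a n 2≤n)
    penult-col-P+2 : f n (P + 2) (P + 1) ≡ 0
    penult-col-P+2 = subst₂ (λ r c → f n r c ≡ 0) size size-1 (col2n-1b n 2≤n)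
    last-row : ∀ k → 1 ≤ k → k ≤ P → f n (P + 2) k ≡ R p k
    last-row k 1≤k k≤P =
      subst (λ r → f n r k ≡ R p k) size (row2n n 2≤n k 1≤k (subst (k ≤_) (sym size-2) k≤P))
    last-row-P+2 : f n (P + 2) (P + 2) ≡ 0
    last-row-P+2 = subst (λ c → f n c c ≡ 0) size (row2nb n 2≤n)
    penult-row : ∀ k → 1 ≤ k → k ≤ P → f n (P + 1) k ≡ R p k + C p k
    penult-row k 1≤k k≤P =
      subst (λ r → f n r k ≡ R p k + C p k) size-1 (row2n-1 n 2≤n k 1≤k (subst (k ≤_) (sym size-2) k≤P))
    penult-row-P+2 : f n (P + 1) (P + 2) ≡ 0
    penult-row-P+2 = subst₂ (λ r c → f n r c ≡ 0) size-1 size (row2n-1b n 2≤n)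
    beyond-row : ∀ i k → P + 2 < i → f n i k ≡ 0
    beyond-row i k lt = outside n i k (s≤s z≤n) (inj₂ (inj₁ (subst (_< i) (sym size) lt)))
    beyond-col : ∀ i k → P + 2 < k → f n i k ≡ 0
    beyond-col i k lt = outside n i k (s≤s z≤n) (inj₂ (inj₂ (inj₂ (subst (_< k) (sym size) lt))))
    col-zero : ∀ i → f n i 0 ≡ 0
    col-zero i = outside n i 0 (s≤s z≤n) (inj₂ (inj₂ (inj₁ refl)))

  colsum-reflect : ∀ ℓ L → 2 * ℓ ≡ L →
    (∀ i k → 1 ≤ i → i ≤ L → 1 ≤ k → k ≤ L → f ℓ i k ≡ f ℓ (L + 1 ∸ k) (L + 1 ∸ i)) →
    ∀ k → 1 ≤ k → k ≤ L → C ℓ k ≡ R ℓ (L + 1 ∸ k)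
  colsum-reflect ℓ L size symm k 1≤k k≤L = begin
      sumTo (λ i → f ℓ i k) (2 * ℓ)                ≡⟨ cong (sumTo (λ i → f ℓ i k)) size ⟩
      sumTo (λ i → f ℓ i k) L                      ≡⟨ sumTo-cong _ _ L (λ i 1≤i i≤L → symm i k 1≤i i≤L 1≤k k≤L) ⟩
      sumTo (λ i → f ℓ (L + 1 ∸ k) (L + 1 ∸ i)) L  ≡⟨ sumTo-reverse (f ℓ (L + 1 ∸ k)) L ⟩
      sumTo (f ℓ (L + 1 ∸ k)) L                    ≡⟨ cong (sumTo (f ℓ (L + 1 ∸ k))) (sym size) ⟩
      R ℓ (L + 1 ∸ k)                              ∎
    where open ≡-Reasoning

  symmetric-level-1 : ∀ i k → 1 ≤ i → i ≤ 2 → 1 ≤ k → k ≤ 2 → f 1 i k ≡ f 1 (2 + 1 ∸ k) (2 + 1 ∸ i)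
  symmetric-level-1 1 1 _ _ _ _ = trans init11 (sym init22)
  symmetric-level-1 1 2 _ _ _ _ = refl
  symmetric-level-1 2 1 _ _ _ _ = refl
  symmetric-level-1 2 2 _ _ _ _ = trans init22 (sym init11)
  symmetric-level-1 (suc (suc (suc i))) k _ (s≤s (s≤s ())) _ _
  symmetric-level-1 1 (suc (suc (suc k))) _ _ _ (s≤s (s≤s ()))
  symmetric-level-1 2 (suc (suc (suc k))) _ _ _ (s≤s (s≤s ()))

  -- The induction step: the invariant at level p = t + 1 ≥ 2 implies the
  -- invariant at level n = p + 1.  Each field is proved by backward
  -- uniqueness of the recurrence, matching boundary values on the last
  -- two rows or columns, which conditions (d) and (e) express through the
  -- previous level.
  module Step (t : ℕ) (1≤t : 1 ≤ t) (IH : Invariant (suc t) (2 * suc t)) where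
    p : ℕ
    p = suc t
    open Level p (s≤s z≤n)
    open Invariant IH

    1≤P : 1 ≤ P
    1≤P = s≤s z≤n
    2≤P : 2 ≤ P
    2≤P = subst (2 ≤_) (sym (*-suc 2 t)) (m≤m+n 2 (2 * t))

    prev-rowsum-1 : R p 1 ≡ 0
    prev-rowsum-1 = sumTo-zero _ P (λ j _ _ → row1-zero j)
    prev-rowsum-beyond : ∀ k → P < k → R p k ≡ 0
    prev-rowsum-beyond k P<k = sumTo-zero _ P (λ j _ _ → outside p k j (s≤s z≤n) (inj₂ (inj₁ P<k)))

    reflect-P+1 : P + 2 + 1 ∸ (P + 1) ≡ 2
    reflect-P+1 = ∸-from-+ {P + 1} (trans (+-assoc P 1 2) (sym (+-assoc P 2 1)))
    reflect-P+2 : P + 2 + 1 ∸ (P + 2) ≡ 1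
    reflect-P+2 = m+n∸m≡n (P + 2) 1

    -- Row 1 of level n vanishes: it solves the row recurrence with zero
    -- source and zero top values R p 1 and 0.
    row1-zero-n : ∀ k → f n 1 k ≡ 0
    row1-zero-n zero          = col-zero 1
    row1-zero-n (suc zero)    = diagonal 1 ≤-refl (s≤s z≤n)
    row1-zero-n (suc (suc k)) with suc (suc k) ≤? P + 2
    ... | no k≰ = beyond-col 1 _ (≰⇒> k≰)
    ... | yes k≤ = rec-unique {x = f n 1} {y = λ _ → 0} {s = f p 1} {t = λ _ → 0} 2 P
      (λ _ → trans (penult-col 1 ≤-refl 1≤P) prev-rowsum-1) (last-col 1 ≤-refl (s≤s z≤n))
      (λ j 2≤j j≤P → upper-rec 1 j ≤-refl 2≤j j≤P) (λ _ _ _ → refl) (λ j _ _ → row1-zero j)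
      (suc (suc k)) (s≤s (s≤s z≤n)) k≤

    -- A solution on [a, P] whose source is the reflected row sums of level
    -- t and whose top values are R p 2 and R p 1 is the reflected row sums
    -- of level p.  This describes column 1 and row 2 of level n.
    reflected-rowsums : ∀ (x s : ℕ → ℕ) a → 2 ≤ a →
      (a ≤ P + 1 → x (P + 1) ≡ R p 2) → x (P + 2) ≡ R p 1 →
      (∀ j → a ≤ j → j ≤ P → Rec x s j) →
      (∀ j → a ≤ j → j ≤ P → s j ≡ R t (P + 1 ∸ j)) →
      ∀ j → a ≤ j → j ≤ P + 2 → x j ≡ R p (P + 2 + 1 ∸ j)
    reflected-rowsums x s a 2≤a top₁ top₂ rx eₛ =
      rec-unique {x = x} {y = λ j → R p (P + 2 + 1 ∸ j)} {s = s} {t = s} a P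
        (λ a≤ → trans (top₁ a≤) (cong (R p) (sym reflect-P+1)))
        (trans top₂ (cong (R p) (sym reflect-P+2)))
        rx ry (λ _ _ _ → refl)
      where
      ry : ∀ j → a ≤ j → j ≤ P → Rec (λ j → R p (P + 2 + 1 ∸ j)) s j
      ry j a≤j j≤P with m≤n⇒∃[o]m+o≡n j≤P
      ... | d , j+d≡P =
        rec-reflect {g = R p} {s = R t} {t = s} (P + 2) (d + 1) j
                    (trans (regroup j d) (cong (_+ 2) j+d≡P))
                    (trans (eₛ j a≤j j≤P) (cong (R t) (reflect j+d≡P)))
                    (rowsum-rec (d + 1) (m≤n+m 1 d)
                       (subst (_≤ P) (trans (+-comm 2 d) (sym (+-assoc d 1 1)))
                              (complement-≤ (≤-trans 2≤a a≤j) j+d≡P)))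
        where
        regroup : ∀ j d → j + (d + 1) + 1 ≡ j + d + 2
        regroup = solve-∀

    col1-rowsums-n : ∀ j → 2 ≤ j → j ≤ P + 2 → f n j 1 ≡ R p (P + 2 + 1 ∸ j)
    col1-rowsums-n = reflected-rowsums (λ j → f n j 1) (λ j → f p j 1) 2 ≤-refl
      (λ _ → trans (penult-row 1 ≤-refl 1≤P)
                   (cong₂ _+_ prev-rowsum-1 (colsum-shift 1 ≤-refl 1≤P)))
      (last-row 1 ≤-refl 1≤P)
      (λ j 2≤j j≤P → lower-rec j 1 ≤-refl 2≤j j≤P)
      col1-rowsums

    -- Row 2 of level n (right of the diagonal): again the reflected row
    -- sums of level p, since by symmetry row 2 of level p is column P - 1,
    -- which is given by (d).
    row2-rowsums : ∀ j → 3 ≤ j → j ≤ P + 2 → f n 2 j ≡ R p (P + 2 + 1 ∸ j)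
    row2-rowsums = reflected-rowsums (f n 2) (f p 2) 3 (s≤s (s≤s z≤n))
      (λ _ → penult-col 2 (s≤s z≤n) 2≤P)
      (trans (last-col 2 (s≤s z≤n) (≤-trans 2≤P (m≤m+n P 2))) (sym prev-rowsum-1))
      (λ j 3≤j j≤P → upper-rec 2 j (s≤s z≤n) 3≤j j≤P)
      source
      where
      source : ∀ j → 3 ≤ j → j ≤ P → f p 2 j ≡ R t (P + 1 ∸ j)
      source j 3≤j j≤P with m≤n⇒∃[o]m+o≡n j≤P
      ... | d , j+d≡P = begin
          f p 2 j                         ≡⟨ symmetric 2 j (s≤s z≤n) 2≤P (≤-trans (s≤s z≤n) 3≤j) j≤P ⟩
          f p (P + 1 ∸ j) (P + 1 ∸ 2)     ≡⟨ cong₂ (f p) (reflect j+d≡P) (+1∸2 P) ⟩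
          f p (d + 1) (P ∸ 1)             ≡⟨ col2n-1 p (s≤s 1≤t) (d + 1) (m≤n+m 1 d) d+1≤P-2 ⟩
          R t (d + 1)                     ≡⟨ cong (R t) (sym (reflect j+d≡P)) ⟩
          R t (P + 1 ∸ j)                 ∎
        where
        open ≡-Reasoning
        d+1≤P-2 : d + 1 ≤ P ∸ 2
        d+1≤P-2 = m+n≤o⇒m≤o∸n (d + 1) (subst (_≤ P) (trans (+-comm 3 d) (sym (+-assoc d 1 2))) (complement-≤ 3≤j j+d≡P))

    col1-sum : ∀ j e → 2 ≤ j → 1 ≤ e → j + e ≡ P + 2 + 1 → f n j 1 ≡ R p e
    col1-sum j e 2≤j 1≤e j+e≡ = trans (col1-rowsums-n j 2≤j j≤P+2) (cong (R p) (∸-from-+ j+e≡))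
      where
      j≤P+2 : j ≤ P + 2
      j≤P+2 = +-cancelʳ-≤ 1 j (P + 2) (subst (j + 1 ≤_) j+e≡ (+-monoʳ-≤ j 1≤e))

    -- f n 2 1 = R p (P + 1), an empty row of level p.
    entry-2-1 : f n 2 1 ≡ 0
    entry-2-1 = trans (col1-sum 2 (P + 1) ≤-refl (m≤n+m 1 P) (arrange P)) (prev-rowsum-beyond (P + 1) (m<m+n P (s≤s z≤n)))
      where
      arrange : ∀ P → 2 + (P + 1) ≡ P + 2 + 1
      arrange = solve-∀

    -- The transpose relation of the lower triangle in the last two rows,
    -- where (d) and (e) express both sides through the previous level.
    transpose-last : ∀ k d → 1 ≤ k → k + d ≡ P → f n (P + 2) k ≡ f n k (P + 2) + f n (P + 2 ∸ k + 1) 1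
    transpose-last k d 1≤k k+d≡P = begin
        f n (P + 2) k                         ≡⟨ last-row k 1≤k k≤P ⟩
        R p k                                 ≡⟨ sym (col1-sum (d + 2 + 1) k (≤-trans (m≤n+m 2 d) (m≤m+n (d + 2) 1)) 1≤k
                                                        (trans (regroup d k) (cong (λ m → m + 2 + 1) k+d≡P))) ⟩
        f n (d + 2 + 1) 1                     ≡⟨ cong (λ m → f n (m + 1) 1)
                                                      (sym (∸-from-+ {k} (trans (sym (+-assoc k d 2)) (cong (_+ 2) k+d≡P)))) ⟩
        f n (P + 2 ∸ k + 1) 1                 ≡⟨ cong (_+ f n (P + 2 ∸ k + 1) 1)
                                                      (sym (last-col k 1≤k (≤-trans k≤P (m≤m+n P 2)))) ⟩
        f n k (P + 2) + f n (P + 2 ∸ k + 1) 1 ∎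
      where
      open ≡-Reasoning
      k≤P : k ≤ P
      k≤P = ≤-from-+ d k+d≡P
      regroup : ∀ d k → d + 2 + 1 + k ≡ k + d + 2 + 1
      regroup = solve-∀

    transpose-penult : ∀ k d → 1 ≤ k → k + d ≡ P → f n (P + 1) k ≡ f n k (P + 1) + f n (P + 1 ∸ k + 1) 1
    transpose-penult k d 1≤k k+d≡P = begin
        f n (P + 1) k                         ≡⟨ penult-row k 1≤k k≤P ⟩
        R p k + C p k                         ≡⟨ cong₂ _+_ (sym (penult-col k 1≤k k≤P)) (colsum-shift k 1≤k k≤P) ⟩
        f n k (P + 1) + R p (k + 1)           ≡⟨ cong (f n k (P + 1) +_)
                                                      (sym (col1-sum (d + 1 + 1) (k + 1)
                                                              (subst (2 ≤_) (sym (+-assoc d 1 1)) (m≤n+m 2 d)) (m≤n+m 1 k)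
                                                              (trans (regroup d k) (cong (λ m → m + 2 + 1) k+d≡P)))) ⟩
        f n k (P + 1) + f n (d + 1 + 1) 1     ≡⟨ cong (λ m → f n k (P + 1) + f n (m + 1) 1) (sym (reflect k+d≡P)) ⟩
        f n k (P + 1) + f n (P + 1 ∸ k + 1) 1 ∎
      where
      open ≡-Reasoning
      k≤P : k ≤ P
      k≤P = ≤-from-+ d k+d≡P
      regroup : ∀ d k → d + 1 + 1 + (k + 1) ≡ k + d + 2 + 1
      regroup = solve-∀

    col1-shifted-rec : ∀ k i → 1 ≤ k → k + 1 ≤ i → i ≤ P →
                       Rec (λ i → f n (i ∸ k + 1) 1) (λ i → f p (i ∸ k + 1) 1) i
    col1-shifted-rec k i 1≤k k<i i≤P with m≤n⇒∃[o]m+o≡n k<i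
    ... | u , k+1+u≡i =
      rec-shift {g = λ m → f n (m + 1) 1} {s = λ m → f p (m + 1) 1} k i (≤-trans (m≤m+n k 1) k<i)
        (rec-translate {g = λ m → f n m 1} {s = λ m → f p m 1} 1 (i ∸ k) column-1)
      where
      i-k≡1+u : i ∸ k ≡ 1 + u
      i-k≡1+u = ∸-from-+ {k} (trans (sym (+-assoc k 1 u)) k+1+u≡i)
      column-1 : Rec (λ m → f n m 1) (λ m → f p m 1) (i ∸ k + 1)
      column-1 rewrite i-k≡1+u =
        lower-rec (1 + u + 1) 1 ≤-refl (s≤s (m≤n+m 1 u))
                  (subst (_≤ P) (sym (+-comm (1 + u) 1))
                         (≤-trans (complement-≤ (+-monoˡ-≤ 1 1≤k) k+1+u≡i) i≤P))

    -- Below the diagonal, level n is its own transpose plus a shifted copy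
    -- of column 1: both sides solve the column recurrence (b) and agree on
    -- the last two rows.  Only the corner (P + 2, P + 1) lies outside the
    -- range of (b); there all entries involved vanish.
    lower-transpose-n : ∀ k i → 1 ≤ k → k + 1 ≤ i → i ≤ P + 2 →
                        f n i k ≡ f n k i + f n (i ∸ k + 1) 1
    lower-transpose-n k i 1≤k k<i i≤P+2 with k ≤? P
    ... | yes k≤P with m≤n⇒∃[o]m+o≡n k≤P
    ... | d , k+d≡P =
      rec-unique {x = λ i → f n i k} {y = λ i → f n k i + f n (i ∸ k + 1) 1}
                 {s = λ i → f p i k} {t = λ i → f p k i + f p (i ∸ k + 1) 1}
                 (k + 1) P (λ _ → transpose-penult k d 1≤k k+d≡P) (transpose-last k d 1≤k k+d≡P)
                 (λ i k<i i≤P → lower-rec i k 1≤k k<i i≤P)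
                 (λ i k<i i≤P → rec-+ {x = f n k} {y = λ i → f n (i ∸ k + 1) 1} {s = f p k} {t = λ i → f p (i ∸ k + 1) 1} i
                                  (upper-rec k i 1≤k k<i i≤P) (col1-shifted-rec k i 1≤k k<i i≤P))
                 (λ i k<i i≤P → lower-transpose k i 1≤k k<i i≤P)
                 i k<i i≤P+2
    lower-transpose-n k i 1≤k k<i i≤P+2 | no k≰P = subst₂ Transposed (sym k≡P+1) (sym i≡P+2) corner
      where
      Transposed : ℕ → ℕ → Set
      Transposed k i = f n i k ≡ f n k i + f n (i ∸ k + 1) 1
      k≡P+1 : k ≡ P + 1
      k≡P+1 = ≰-squeeze k≰P (≤-trans k<i i≤P+2)
      i≡P+2 : i ≡ P + 2
      i≡P+2 = ≤-antisym i≤P+2 (subst (_≤ i) (trans (cong (_+ 1) k≡P+1) (+-assoc P 1 1)) k<i)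
      corner : Transposed (P + 1) (P + 2)
      corner = trans penult-col-P+2
        (sym (cong₂ _+_ penult-row-P+2
                        (trans (cong (λ m → f n (m + 1) 1) (∸-from-+ {P + 1} (+-assoc P 1 1))) entry-2-1)))

    col-lhs col-rhs : ℕ → ℕ → ℕ
    col-lhs r c = f n (r + 2) c + f n r c + 2 * f p r (c ∸ 2)
    col-rhs r c = 2 * f n (r + 1) c

    -- Both sides solve the row recurrence (c): the left one as a
    -- combination of rows r + 2, r of level n and row r of level p.
    col-lhs-rec : ∀ r c → 1 ≤ r → r + 3 ≤ c → c ≤ P →
                  Rec (col-lhs r) (λ c → f p (r + 2) c + f p r c + 2 * f t r (c ∸ 2)) c
    col-lhs-rec r c 1≤r r+3≤c c≤P =
      rec-+ {x = λ c → f n (r + 2) c + f n r c} {y = λ c → 2 * f p r (c ∸ 2)}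
            {s = λ c → f p (r + 2) c + f p r c} {t = λ c → 2 * f t r (c ∸ 2)} c
        (rec-+ {x = f n (r + 2)} {y = f n r} {s = f p (r + 2)} {t = f p r} c
           (upper-rec (r + 2) c (≤-trans (s≤s z≤n) (m≤n+m 2 r)) (+-assoc-≤ r 2 1 r+3≤c) c≤P)
           (upper-rec r c 1≤r (m+n≤o⇒m≤o (r + 1) r+1+2≤c) c≤P))
        (rec-2* {x = λ c → f p r (c ∸ 2)} {s = λ c → f t r (c ∸ 2)} c
           (rec-shift {g = f p r} {s = f t r} 2 c (m+n≤o⇒n≤o (r + 1) r+1+2≤c)
              (upper p (s≤s 1≤t) r (c ∸ 2) 1≤r (m+n≤o⇒m≤o∸n (r + 1) r+1+2≤c) (∸-monoˡ-≤ 2 c≤P))))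
      where
      r+1+2≤c : r + 1 + 2 ≤ c
      r+1+2≤c = +-assoc-≤ r 1 2 r+3≤c

    col-rhs-rec : ∀ r c → 1 ≤ r → r + 3 ≤ c → c ≤ P → Rec (col-rhs r) (λ c → 2 * f p (r + 1) c) c
    col-rhs-rec r c 1≤r r+3≤c c≤P =
      rec-2* {x = f n (r + 1)} {s = f p (r + 1)} c
        (upper-rec (r + 1) c (m≤n+m 1 r) (≤-trans (+-monoʳ-≤ (r + 1) (s≤s z≤n)) (+-assoc-≤ r 1 2 r+3≤c)) c≤P)

    col-sides-last : ∀ r → 1 ≤ r → r + 1 ≤ P → col-lhs r (P + 2) ≡ col-rhs r (P + 2)
    col-sides-last r 1≤r r+1≤P = begin
        f n (r + 2) (P + 2) + f n r (P + 2) + 2 * f p r (P + 2 ∸ 2)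
      ≡⟨ cong₂ (λ a b → a + b + 2 * f p r (P + 2 ∸ 2))
               (last-col (r + 2) (≤-trans (s≤s z≤n) (m≤n+m 2 r)) (+-monoˡ-≤ 2 r≤P))
               (last-col r 1≤r (≤-trans r≤P (m≤m+n P 2))) ⟩
        2 * f p r (P + 2 ∸ 2)
      ≡⟨ cong (λ c → 2 * f p r c) (m+n∸n≡m P 2) ⟩
        2 * f p r P
      ≡⟨ cong (2 *_) (col2n p (s≤s 1≤t) r 1≤r r≤P) ⟩
        0
      ≡⟨ cong (2 *_) (sym (last-col (r + 1) (m≤n+m 1 r) (≤-trans r+1≤P (m≤m+n P 2)))) ⟩
        2 * f n (r + 1) (P + 2)
      ∎
      where
      open ≡-Reasoning
      r≤P : r ≤ P
      r≤P = m+n≤o⇒m≤o r r+1≤P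

    -- In column P + 1 it is the row-sum recurrence of level p.
    col-sides-penult : ∀ r → 1 ≤ r → r + 2 ≤ P → col-lhs r (P + 1) ≡ col-rhs r (P + 1)
    col-sides-penult r 1≤r r+2≤P = begin
        f n (r + 2) (P + 1) + f n r (P + 1) + 2 * f p r (P + 1 ∸ 2)
      ≡⟨ cong₂ (λ a b → a + b + 2 * f p r (P + 1 ∸ 2))
               (penult-col (r + 2) (≤-trans (s≤s z≤n) (m≤n+m 2 r)) r+2≤P) (penult-col r 1≤r r≤P) ⟩
        R p (r + 2) + R p r + 2 * f p r (P + 1 ∸ 2)
      ≡⟨ cong (λ c → R p (r + 2) + R p r + 2 * f p r c) (+1∸2 P) ⟩
        R p (r + 2) + R p r + 2 * f p r (P ∸ 1)
      ≡⟨ cong (λ a → R p (r + 2) + R p r + 2 * a) (col2n-1 p (s≤s 1≤t) r 1≤r (m+n≤o⇒m≤o∸n r r+2≤P)) ⟩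
        R p (r + 2) + R p r + 2 * R t r
      ≡⟨ rowsum-rec r 1≤r r+1≤P ⟩
        2 * R p (r + 1)
      ≡⟨ cong (2 *_) (sym (penult-col (r + 1) (m≤n+m 1 r) r+1≤P)) ⟩
        2 * f n (r + 1) (P + 1)
      ∎
      where
      open ≡-Reasoning
      r+1≤P : r + 1 ≤ P
      r+1≤P = ≤-trans (+-monoʳ-≤ r (s≤s z≤n)) r+2≤P
      r≤P : r ≤ P
      r≤P = m+n≤o⇒m≤o r r+1≤P

    -- Above the diagonal, level n also satisfies a recurrence down each
    -- column, with source the previous level moved two columns left: both
    -- sides solve the row recurrence in c and agree on the last two columns.
    upper-col-rec-n : ∀ r c → 1 ≤ r → r + 3 ≤ c → c ≤ P + 2 →
                      Rec (λ m → f n m c) (λ m → f p m (c ∸ 2)) r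
    upper-col-rec-n r c 1≤r r+3≤c c≤P+2 =
      rec-unique {x = col-lhs r} {y = col-rhs r}
                 {s = λ c → f p (r + 2) c + f p r c + 2 * f t r (c ∸ 2)} {t = λ c → 2 * f p (r + 1) c}
                 (r + 3) P
                 (λ r+3≤P+1 → col-sides-penult r 1≤r (+-cancelʳ-≤ 1 (r + 2) P (+-assoc-≤ r 2 1 r+3≤P+1)))
                 (col-sides-last r 1≤r (+-cancelʳ-≤ 2 (r + 1) P (+-assoc-≤ r 1 2 (≤-trans r+3≤c c≤P+2))))
                 (λ c → col-lhs-rec r c 1≤r) (λ c → col-rhs-rec r c 1≤r)
                 (λ c r+3≤c c≤P → upper-col-rec r c 1≤r r+3≤c c≤P)
                 c r+3≤c c≤P+2

    -- Column P + 3 - i, read bottom to top from row P + 3 - k, solves the row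
    -- recurrence of row i: it is the column recurrence of the upper
    -- triangle reflected, and its source matches by symmetry of level p.
    reflected-column-rec : ∀ i d k → 1 ≤ i → i + d ≡ P + 2 → i + 1 ≤ k → k ≤ P →
                           Rec (λ k → f n (P + 2 + 1 ∸ k) (P + 2 + 1 ∸ i)) (f p i) k
    reflected-column-rec i d k 1≤i i+d≡P+2 i<k k≤P with m≤n⇒∃[o]m+o≡n k≤P
    ... | e , k+e≡P =
      rec-reflect {g = λ r → f n r i'} {s = λ r → f p r (i' ∸ 2)} {t = f p i} (P + 2) (e + 1) k
        (trans (regroup k e) (cong (_+ 2) k+e≡P))
        (trans (symmetric i k 1≤i i≤P (≤-trans (m≤n+m 1 i) i<k) k≤P)
               (cong₂ (f p) (reflect k+e≡P) (sym (reflect-shift P i))))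
        (upper-col-rec-n (e + 1) i' (m≤n+m 1 e) e+1+3≤i' (reflect-≤ 1≤i i+d≡P+2))
      where
      i' : ℕ
      i' = P + 2 + 1 ∸ i
      regroup : ∀ k e → k + (e + 1) + 1 ≡ k + e + 2
      regroup = solve-∀
      regroup′ : ∀ i e → i + 1 + (e + 2) ≡ i + (e + 3)
      regroup′ = solve-∀
      regroup″ : ∀ e → e + 3 + 1 ≡ e + 1 + 3
      regroup″ = solve-∀
      e+3≤d : e + 3 ≤ d
      e+3≤d = +-cancelˡ-≤ i (e + 3) d
        (subst₂ _≤_ (regroup′ i e) (trans (sym (+-assoc k e 2)) (trans (cong (_+ 2) k+e≡P) (sym i+d≡P+2)))
                (+-monoˡ-≤ (e + 2) i<k))
      e+1+3≤i' : e + 1 + 3 ≤ i'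
      e+1+3≤i' = subst₂ _≤_ (regroup″ e) (sym (reflect i+d≡P+2)) (+-monoˡ-≤ 1 e+3≤d)
      i≤P : i ≤ P
      i≤P = ≤-trans (m≤m+n i 1) (≤-trans i<k k≤P)

    reflected-penult : ∀ i d → 1 ≤ i → i ≤ P → i + d ≡ P + 2 → f n i (P + 1) ≡ f n 2 (P + 2 + 1 ∸ i)
    reflected-penult i d 1≤i i≤P i+d≡P+2 = begin
        f n i (P + 1)                   ≡⟨ penult-col i 1≤i i≤P ⟩
        R p i                           ≡⟨ cong (R p) (sym (∸-from-+ {i'} (trans (cong (_+ i) (reflect i+d≡P+2))
                                                                               (trans (regroup d i) (cong (_+ 1) i+d≡P+2))))) ⟩
        R p (P + 2 + 1 ∸ i')            ≡⟨ sym (row2-rowsums i' 3≤i' (reflect-≤ 1≤i i+d≡P+2)) ⟩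
        f n 2 i'                        ∎
      where
      open ≡-Reasoning
      i' : ℕ
      i' = P + 2 + 1 ∸ i
      regroup : ∀ d i → d + 1 + i ≡ i + d + 1
      regroup = solve-∀
      3≤i' : 3 ≤ i'
      3≤i' = subst (3 ≤_) (sym (reflect i+d≡P+2))
               (+-monoˡ-≤ 1 (+-cancelˡ-≤ i 2 d (subst (i + 2 ≤_) (sym i+d≡P+2) (+-monoˡ-≤ 2 i≤P))))

    -- Above the diagonal, row i read left to right agrees with column
    -- P + 3 - i read bottom to top: both solve the row recurrence (c), and
    -- in the last two columns they are given by rows 1 and 2.
    symmetric-upper : ∀ i k → 1 ≤ i → i + 1 ≤ k → k ≤ P + 2 →
                      f n i k ≡ f n (P + 2 + 1 ∸ k) (P + 2 + 1 ∸ i)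
    symmetric-upper i k 1≤i i<k k≤P+2 with m≤n⇒∃[o]m+o≡n (≤-trans (m≤m+n i 1) (≤-trans i<k k≤P+2))
    ... | d , i+d≡P+2 =
      rec-unique {x = f n i} {y = λ k → f n (P + 2 + 1 ∸ k) (P + 2 + 1 ∸ i)} {s = f p i} {t = f p i}
                 (i + 1) P
                 (λ i+1≤P+1 → trans (reflected-penult i d 1≤i (+-cancelʳ-≤ 1 i P i+1≤P+1) i+d≡P+2)
                                    (cong (λ r → f n r (P + 2 + 1 ∸ i)) (sym reflect-P+1)))
                 (trans (last-col i 1≤i (≤-trans (m≤m+n i 1) (≤-trans i<k k≤P+2)))
                        (sym (trans (cong (λ r → f n r (P + 2 + 1 ∸ i)) reflect-P+2) (row1-zero-n _))))
                 (λ k i<k k≤P → upper-rec i k 1≤i i<k k≤P)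
                 (λ k → reflected-column-rec i d k 1≤i i+d≡P+2)
                 (λ _ _ _ → refl) k i<k k≤P+2

    -- The symmetry of level n: above the diagonal by the previous lemma,
    -- on it trivially, and below it by reducing to the upper triangle.
    symmetric-n : ∀ i k → 1 ≤ i → i ≤ P + 2 → 1 ≤ k → k ≤ P + 2 →
                  f n i k ≡ f n (P + 2 + 1 ∸ k) (P + 2 + 1 ∸ i)
    symmetric-n i k 1≤i i≤P+2 1≤k k≤P+2
      with m≤n⇒∃[o]m+o≡n i≤P+2 | m≤n⇒∃[o]m+o≡n k≤P+2 | <-cmp i k
    ... | _ , _ | _ , _ | tri< i<k _ _ =
      symmetric-upper i k 1≤i (subst (_≤ k) (+-comm 1 i) i<k) k≤P+2
    ... | a , i+a≡ | _ , _ | tri≈ _ refl _ =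
      trans (diagonal i 1≤i i≤P+2) (sym (diagonal (P + 2 + 1 ∸ i) (reflect-≥1 {i} i+a≡) (reflect-≤ 1≤i i+a≡)))
    ... | a , i+a≡ | b , k+b≡ | tri> _ _ k<i with m≤n⇒∃[o]m+o≡n (subst (_≤ i) (+-comm 1 k) k<i)
    ... | u , k+1+u≡i = begin
        f n i k                      ≡⟨ lower-transpose-n k i 1≤k k+1≤i i≤P+2 ⟩
        f n k i + f n (i ∸ k + 1) 1  ≡⟨ cong₂ _+_ (symmetric-upper k i 1≤k k+1≤i i≤P+2)
                                              (cong (λ m → f n (m + 1) 1) (trans i-k≡1+u (sym B-A≡1+u))) ⟩
        f n A B + f n (B ∸ A + 1) 1  ≡⟨ sym (lower-transpose-n A B (reflect-≥1 {i} i+a≡) (≤-from-+ u A+1+u≡B)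
                                                              (reflect-≤ 1≤k k+b≡)) ⟩
        f n B A                      ∎
      where
      open ≡-Reasoning
      A B : ℕ
      A = P + 2 + 1 ∸ i
      B = P + 2 + 1 ∸ k
      k+1≤i : k + 1 ≤ i
      k+1≤i = subst (_≤ i) (+-comm 1 k) k<i
      A+1+u≡B : A + 1 + u ≡ B
      A+1+u≡B = reflect-gap i+a≡ k+b≡ k+1+u≡i
      i-k≡1+u : i ∸ k ≡ 1 + u
      i-k≡1+u = ∸-from-+ {k} (trans (sym (+-assoc k 1 u)) k+1+u≡i)
      B-A≡1+u : B ∸ A ≡ 1 + u
      B-A≡1+u = ∸-from-+ {A} (trans (sym (+-assoc A 1 u)) A+1+u≡B)

    -- Along the first two superdiagonals,
    --   2 f(k, k+2) + f(3, 1) = f(k, k+1) + f(k+1, k+2),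
    -- by backward induction from k = P, combining the row recurrence in
    -- row k with the column recurrence in column k + 3.
    superdiagonal : ∀ k → 1 ≤ k → k ≤ P →
                    2 * f n k (k + 2) + f n 3 1 ≡ f n k (k + 1) + f n (k + 1) (k + 2)
    superdiagonal = descend Q 1 P top step
      where
      Q : ℕ → Set
      Q k = 2 * f n k (k + 2) + f n 3 1 ≡ f n k (k + 1) + f n (k + 1) (k + 2)
      top : Q P
      top = begin
          2 * f n P (P + 2) + f n 3 1  ≡⟨ cong₂ (λ a b → 2 * a + b) (last-col P 1≤P (m≤m+n P 2))
                                                (col1-sum 3 P (s≤s (s≤s z≤n)) 1≤P (trans (+-comm 3 P) (sym (+-assoc P 2 1)))) ⟩
          R p P                        ≡⟨ sym (+-identityʳ (R p P)) ⟩
          R p P + 0                    ≡⟨ cong₂ _+_ (sym (penult-col P 1≤P ≤-refl)) (sym penult-row-P+2) ⟩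
          f n P (P + 1) + f n (P + 1) (P + 2) ∎
        where open ≡-Reasoning
      step : ∀ k → 1 ≤ k → k < P → Q (k + 1) → Q k
      step k 1≤k k<P next =
        superdiagonal-step (f n k (k + 1 + 2)) (f n k (k + 1)) (f p k (k + 1)) (f n k (k + 2))
                           (f n (k + 2) (k + 1 + 2)) (f n (k + 1) (k + 1 + 2)) (f n (k + 1) (k + 2)) (f n 3 1)
          (subst (λ c → f n k (k + 1 + 2) + f n k (k + 1) + 2 * f p k (k + 1) ≡ 2 * f n k c) (+-assoc k 1 1)
                 (upper-rec k (k + 1) 1≤k ≤-refl k+1≤P))
          (subst (λ c → f n (k + 2) (k + 1 + 2) + f n k (k + 1 + 2) + 2 * f p k c ≡ 2 * f n (k + 1) (k + 1 + 2))
                 (m+n∸n≡m (k + 1) 2)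
                 (upper-col-rec-n k (k + 1 + 2) 1≤k (≤-reflexive (sym (+-assoc k 1 2))) (+-monoˡ-≤ 2 k+1≤P)))
          (subst (λ r → 2 * f n (k + 1) (k + 1 + 2) + f n 3 1 ≡ f n (k + 1) r + f n r (k + 1 + 2)) (+-assoc k 1 1) next)
        where
        k+1≤P : k + 1 ≤ P
        k+1≤P = subst (_≤ P) (+-comm 1 k) k<P

    lower-transpose-offset : ∀ j i d → 1 ≤ j → j + 1 ≤ i → i ≤ P + 2 → j + d ≡ i → f n i j ≡ f n j i + f n (d + 1) 1
    lower-transpose-offset j i d 1≤j j<i i≤ j+d≡i =
      trans (lower-transpose-n j i 1≤j j<i i≤) (cong (λ m → f n j i + f n (m + 1) 1) (∸-from-+ j+d≡i))

    -- The 3 × 3 block in rows and columns k, k+1, k+2 satisfies the row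
    -- recurrence with zero source: below the diagonal it is the transpose
    -- (plus entries of column 1), and the superdiagonal identity closes it.
    near-diagonal : ∀ k → 1 ≤ k → k ≤ P →
                    Rec (λ r → f n r k + f n r (k + 1) + f n r (k + 2)) (λ _ → 0) k
    near-diagonal k 1≤k k≤P
      rewrite lower-transpose-offset k (k + 2) 2 1≤k (+-monoʳ-≤ k (s≤s z≤n)) (+-monoˡ-≤ 2 k≤P) refl
            | lower-transpose-offset k (k + 1) 1 1≤k ≤-refl (+-mono-≤ k≤P (s≤s z≤n)) refl
            | lower-transpose-offset (k + 1) (k + 2) 1 (m≤n+m 1 k) (≤-reflexive (+-assoc k 1 1)) (+-monoˡ-≤ 2 k≤P) (+-assoc k 1 1)
            | entry-2-1
            | diagonal k 1≤k (≤-trans k≤P (m≤m+n P 2))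
            | diagonal (k + 1) (m≤n+m 1 k) (+-mono-≤ k≤P (s≤s z≤n))
            | diagonal (k + 2) (≤-trans (s≤s z≤n) (m≤n+m 2 k)) (+-monoˡ-≤ 2 k≤P)
      = block-identity (f n k (k + 2)) (f n 3 1) (f n (k + 1) (k + 2)) (f n k (k + 1)) (superdiagonal k 1≤k k≤P)

    -- Partial row sums over the columns left of k solve the recurrence at
    -- k, termwise by the column recurrence (b).
    rowsum-head-rec : ∀ k → 1 ≤ k → k ≤ P →
                      Rec (λ r → sumTo (f n r) (k ∸ 1)) (λ r → sumTo (f p r) (k ∸ 1)) k
    rowsum-head-rec k 1≤k k≤P = rec-sumTo (f n) (f p) (k ∸ 1) k
      (λ j 1≤j j≤k-1 → lower-rec k j 1≤j (m≤o∸n⇒m+n≤o j 1≤k j≤k-1) k≤P)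

    -- Partial row sums over the columns right of k + 2 solve the recurrence
    -- at k, termwise by the column recurrence of the upper triangle.
    rowsum-tail-rec : ∀ k b → 1 ≤ k → k + 2 + b ≡ P + 2 →
                      Rec (λ r → sumTo (λ i → f n r (k + 2 + i)) b) (λ r → sumTo (λ i → f p r (k + i)) b) k
    rowsum-tail-rec k b 1≤k k+2+b≡ = rec-sumTo (λ r i → f n r (k + 2 + i)) (λ r i → f p r (k + i)) b k column
      where
      regroup : ∀ k i → 2 + (k + i) ≡ k + 2 + i
      regroup = solve-∀
      column : ∀ i → 1 ≤ i → i ≤ b → Rec (λ r → f n r (k + 2 + i)) (λ r → f p r (k + i)) k
      column i 1≤i i≤b =
        rec-transport {x = λ r → f n r (k + 2 + i)} {y = λ r → f n r (k + 2 + i)}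
                      {s = λ r → f p r (k + 2 + i ∸ 2)} {t = λ r → f p r (k + i)} k refl refl refl
          (cong (f p k) (∸-from-+ {2} (regroup k i)))
          (upper-col-rec-n k (k + 2 + i) 1≤k (subst (_≤ k + 2 + i) (+-assoc k 2 1) (+-monoʳ-≤ (k + 2) 1≤i))
                           (subst (k + 2 + i ≤_) k+2+b≡ (+-monoʳ-≤ (k + 2) i≤b)))

    -- The row-sum recurrence of level n in rows k ≤ P: split each row into
    -- the columns before k, the 3 × 3 block at the diagonal, and the columns
    -- after k + 2; the source splits alike, with f p k k = 0 in the middle.
    rowsum-rec-inner : ∀ k → 1 ≤ k → k ≤ P → Rec (R n) (R p) k
    rowsum-rec-inner k 1≤k k≤P with m≤n⇒∃[o]m+o≡n k≤P
    ... | b , k+b≡P =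
      rec-transport {x = λ r → H r + M r + T r} {y = R n} {s = λ r → Hs r + 0 + Ts r} {t = R p} k
        (split k) (split (k + 1)) (split (k + 2)) source
        (rec-+ {x = λ r → H r + M r} {y = T} {s = λ r → Hs r + 0} {t = Ts} k
          (rec-+ {x = H} {y = M} {s = Hs} {t = λ _ → 0} k (rowsum-head-rec k 1≤k k≤P) (near-diagonal k 1≤k k≤P))
          (rowsum-tail-rec k b 1≤k k+2+b≡))
      where
      open ≡-Reasoning
      H M T Hs Ts : ℕ → ℕ
      H r = sumTo (f n r) (k ∸ 1)
      M r = f n r k + f n r (k + 1) + f n r (k + 2)
      T r = sumTo (λ i → f n r (k + 2 + i)) b
      Hs r = sumTo (f p r) (k ∸ 1)
      Ts r = sumTo (λ i → f p r (k + i)) b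
      regroup : ∀ k b → k + b + 2 ≡ k + 2 + b
      regroup = solve-∀
      k+2+b≡ : k + 2 + b ≡ P + 2
      k+2+b≡ = trans (sym (regroup k b)) (cong (_+ 2) k+b≡P)
      split : ∀ r → H r + M r + T r ≡ R n r
      split r = sym (trans (cong (sumTo (f n r)) (trans size (sym k+2+b≡))) (sumTo-around (f n r) k b 1≤k))
      source : Hs k + 0 + Ts k ≡ R p k
      source = begin
        Hs k + 0 + Ts k              ≡⟨ cong (λ u → Hs k + u + Ts k) (sym (diag p (s≤s 1≤t) k 1≤k k≤P)) ⟩
        Hs k + f p k k + Ts k        ≡⟨ cong (_+ Ts k) (sym (sumTo-last (f p k) k 1≤k)) ⟩
        sumTo (f p k) k + Ts k       ≡⟨ sym (sumTo-split (f p k) k b) ⟩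
        sumTo (f p k) (k + b)        ≡⟨ cong (sumTo (f p k)) k+b≡P ⟩
        R p k                        ∎

    -- The last two rows of level n sum to twice, resp. once, the total of
    -- level p: the column sums of level p are its row sums shifted by one,
    -- and R p 1 = R p (P + 1) = 0.
    prev-total : ℕ
    prev-total = sumTo (R p) P

    prev-colsums-total : sumTo (C p) P ≡ prev-total
    prev-colsums-total = begin
        sumTo (C p) P                        ≡⟨ sumTo-cong _ _ P (λ j 1≤j j≤P → trans (colsum-shift j 1≤j j≤P)
                                                                                 (cong (R p) (+-comm j 1))) ⟩
        sumTo (λ j → R p (suc j)) P          ≡⟨ cong (_+ sumTo (λ j → R p (suc j)) P) (sym prev-rowsum-1) ⟩
        R p 1 + sumTo (λ j → R p (suc j)) P  ≡⟨ sym (sumTo-first (R p) P) ⟩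
        prev-total + R p (suc P)             ≡⟨ cong (prev-total +_) (prev-rowsum-beyond (suc P) ≤-refl) ⟩
        prev-total + 0                       ≡⟨ +-identityʳ prev-total ⟩
        prev-total                           ∎
      where open ≡-Reasoning

    sum-first-P : ∀ (g : ℕ → ℕ) → g (P + 1) ≡ 0 → g (P + 2) ≡ 0 → sumTo g (2 * n) ≡ sumTo g P
    sum-first-P g z₁ z₂ = begin
        sumTo g (2 * n)                  ≡⟨ cong (sumTo g) size ⟩
        sumTo g (P + 2)                  ≡⟨ sumTo-last-two g P ⟩
        sumTo g P + g (P + 1) + g (P + 2) ≡⟨ cong₂ (λ a b → sumTo g P + a + b) z₁ z₂ ⟩
        sumTo g P + 0 + 0                ≡⟨ trans (+-identityʳ _) (+-identityʳ _) ⟩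
        sumTo g P                        ∎
      where open ≡-Reasoning

    rowsum-penult : R n (P + 1) ≡ prev-total + prev-total
    rowsum-penult = begin
        R n (P + 1)                             ≡⟨ sum-first-P (f n (P + 1)) penult-col-P+1 penult-row-P+2 ⟩
        sumTo (f n (P + 1)) P                   ≡⟨ sumTo-cong _ _ P penult-row ⟩
        sumTo (λ j → R p j + C p j) P           ≡⟨ sumTo-+ (R p) (C p) P ⟩
        prev-total + sumTo (C p) P              ≡⟨ cong (prev-total +_) prev-colsums-total ⟩
        prev-total + prev-total                 ∎
      where open ≡-Reasoning

    rowsum-last : R n (P + 2) ≡ prev-total
    rowsum-last = trans (sum-first-P (f n (P + 2)) penult-col-P+2 last-row-P+2) (sumTo-cong _ _ P last-row)

    rowsum-beyond : ∀ k → P + 2 < k → R n k ≡ 0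
    rowsum-beyond k lt = sumTo-zero _ (2 * n) (λ j _ _ → beyond-row k j lt)

    -- The row-sum recurrence of level n; the last row k = P + 1 follows
    -- from the totals above.
    rowsum-rec-n : ∀ k → 1 ≤ k → k + 1 ≤ P + 2 → Rec (R n) (R p) k
    rowsum-rec-n k 1≤k k+1≤P+2 with k ≤? P
    ... | yes k≤P = rowsum-rec-inner k 1≤k k≤P
    ... | no k≰P = subst (Rec (R n) (R p)) (sym (≰-squeeze k≰P k+1≤P+2)) last
      where
      open ≡-Reasoning
      regroup : ∀ P → P + 1 + 2 ≡ suc (P + 2)
      regroup = solve-∀
      last : Rec (R n) (R p) (P + 1)
      last = begin
          R n (P + 1 + 2) + R n (P + 1) + 2 * R p (P + 1)
        ≡⟨ cong₂ (λ a b → a + R n (P + 1) + 2 * b)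
                 (rowsum-beyond (P + 1 + 2) (≤-reflexive (sym (regroup P)))) (prev-rowsum-beyond (P + 1) (m<m+n P (s≤s z≤n))) ⟩
          0 + R n (P + 1) + 2 * 0
        ≡⟨ trans (+-identityʳ (R n (P + 1))) rowsum-penult ⟩
          prev-total + prev-total
        ≡⟨ cong (prev-total +_) (sym (+-identityʳ prev-total)) ⟩
          2 * prev-total
        ≡⟨ cong (2 *_) (sym (trans (cong (R n) (+-assoc P 1 1)) rowsum-last)) ⟩
          2 * R n (P + 1 + 1)
        ∎

    -- Column sums of level n are the row sums shifted by one: by symmetry
    -- the column sums are the reflected row sums, so both sides solve the
    -- row-sum recurrence, and they agree on the last two columns.
    colsum-shift-n : ∀ k → 1 ≤ k → k ≤ P + 2 → C n k ≡ R n (k + 1)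
    colsum-shift-n =
      rec-unique {x = C n} {y = λ k → R n (k + 1)} {s = C p} {t = λ k → R p (k + 1)} 1 P
                 top₁ top₂ rx ry colsum-shift
      where
      colsum-n : ∀ k → 1 ≤ k → k ≤ P + 2 → C n k ≡ R n (P + 2 + 1 ∸ k)
      colsum-n = colsum-reflect n (P + 2) size symmetric-n
      top₂ : C n (P + 2) ≡ R n (P + 2 + 1)
      top₂ = trans (sumTo-zero _ (2 * n) (λ i 1≤i i≤ → last-col i 1≤i (subst (i ≤_) size i≤)))
                   (sym (rowsum-beyond (P + 2 + 1) (m<m+n (P + 2) (s≤s z≤n))))
      top₁ : 1 ≤ P + 1 → C n (P + 1) ≡ R n (P + 1 + 1)
      top₁ _ = trans (sum-first-P (λ i → f n i (P + 1)) penult-col-P+1 penult-col-P+2)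
                     (trans (sumTo-cong _ _ P penult-col)
                            (sym (trans (cong (R n) (+-assoc P 1 1)) rowsum-last)))
      rx : ∀ k → 1 ≤ k → k ≤ P → Rec (C n) (C p) k
      rx k 1≤k k≤P with m≤n⇒∃[o]m+o≡n k≤P
      ... | d , k+d≡P =
        rec-transport {x = λ c → R n (P + 2 + 1 ∸ c)} {y = C n} {s = C p} {t = C p} k
          (sym (colsum-n k 1≤k (≤-trans k≤P (m≤m+n P 2))))
          (sym (colsum-n (k + 1) (m≤n+m 1 k) (+-mono-≤ k≤P (s≤s z≤n))))
          (sym (colsum-n (k + 2) (≤-trans (s≤s z≤n) (m≤n+m 2 k)) (+-monoˡ-≤ 2 k≤P)))
          refl
          (rec-reflect {g = R n} {s = R p} {t = C p} (P + 2) (d + 1) k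
             (trans (regroup k d) (cong (_+ 2) k+d≡P))
             (trans (colsum-reflect p P refl symmetric k 1≤k k≤P) (cong (R p) (reflect k+d≡P)))
             (rowsum-rec-n (d + 1) (m≤n+m 1 d)
                (subst (_≤ P + 2) (sym (+-assoc d 1 1)) (+-monoˡ-≤ 2 (≤-from-+ k (trans (+-comm d k) k+d≡P))))))
        where
        regroup : ∀ k d → k + (d + 1) + 1 ≡ k + d + 2
        regroup = solve-∀
      ry : ∀ k → 1 ≤ k → k ≤ P → Rec (λ k → R n (k + 1)) (λ k → R p (k + 1)) k
      ry k 1≤k k≤P = rec-translate {g = R n} {s = R p} 1 k
        (rowsum-rec-n (k + 1) (m≤n+m 1 k) (subst (k + 1 + 1 ≤_) (+-assoc P 1 1) (+-monoˡ-≤ 1 (+-monoˡ-≤ 1 k≤P))))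

    step : Invariant n (2 * n)
    step = subst (Invariant n) (sym size) record
      { row1-zero       = row1-zero-n
      ; col1-rowsums    = col1-rowsums-n
      ; lower-transpose = lower-transpose-n
      ; upper-col-rec   = upper-col-rec-n
      ; symmetric       = symmetric-n
      ; rowsum-rec      = rowsum-rec-n
      ; colsum-shift    = colsum-shift-n
      }

  -- Level 2, computed entry by entry from the defining conditions; every
  -- field of the invariant is then a finite check.
  module LevelTwo where
    open Level 1 ≤-refl

    M₁ M₂ : ℕ → ℕ → ℕ
    M₁ 2 1 = 1
    M₁ _ _ = 0
    M₂ 2 3 = 1
    M₂ 3 1 = 1
    M₂ 3 2 = 1
    M₂ 4 2 = 1
    M₂ _ _ = 0

    level-1 : ∀ i k → f 1 i k ≡ M₁ i k
    level-1 0 k = outside 1 0 k ≤-refl (inj₁ refl)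
    level-1 (suc (suc (suc i))) k = outside 1 _ k ≤-refl (inj₂ (inj₁ (s≤s (s≤s (s≤s z≤n)))))
    level-1 1 0 = outside 1 1 0 ≤-refl (inj₂ (inj₂ (inj₁ refl)))
    level-1 2 0 = outside 1 2 0 ≤-refl (inj₂ (inj₂ (inj₁ refl)))
    level-1 1 (suc (suc (suc k))) = outside 1 1 _ ≤-refl (inj₂ (inj₂ (inj₂ (s≤s (s≤s (s≤s z≤n))))))
    level-1 2 (suc (suc (suc k))) = outside 1 2 _ ≤-refl (inj₂ (inj₂ (inj₂ (s≤s (s≤s (s≤s z≤n))))))
    level-1 1 1 = init11
    level-1 1 2 = init12
    level-1 2 1 = init21
    level-1 2 2 = init22

    rows₁ : ∀ k → R 1 k ≡ sumTo (M₁ k) 2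
    rows₁ k = sumTo-cong _ _ 2 (λ j _ _ → level-1 k j)
    cols₁ : ∀ k → C 1 k ≡ sumTo (λ i → M₁ i k) 2
    cols₁ k = sumTo-cong _ _ 2 (λ i _ _ → level-1 i k)

    -- The two entries not on the boundary come from the recurrences (b), (c).
    entry-2-1 : f 2 2 1 ≡ 0
    entry-2-1 = +-cancelʳ-≡ 2 (f 2 2 1) 0 (begin
        f 2 2 1 + 2
      ≡⟨ cong₂ (λ a b → a + f 2 2 1 + 2 * b) (sym (trans (last-row 1 ≤-refl (s≤s z≤n)) (rows₁ 1))) (sym init21) ⟩
        f 2 4 1 + f 2 2 1 + 2 * f 1 2 1
      ≡⟨ lower-rec 2 1 ≤-refl ≤-refl ≤-refl ⟩
        2 * f 2 3 1
      ≡⟨ cong (2 *_) (trans (penult-row 1 ≤-refl (s≤s z≤n)) (cong₂ _+_ (rows₁ 1) (cols₁ 1))) ⟩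
        2
      ∎)
      where open ≡-Reasoning
    entry-1-2 : f 2 1 2 ≡ 0
    entry-1-2 = begin
        f 2 1 2
      ≡⟨ sym (+-identityʳ (f 2 1 2)) ⟩
        0 + f 2 1 2 + 2 * 0
      ≡⟨ cong₂ (λ a b → a + f 2 1 2 + 2 * b) (sym (last-col 1 ≤-refl (s≤s z≤n))) (sym init12) ⟩
        f 2 1 4 + f 2 1 2 + 2 * f 1 1 2
      ≡⟨ upper-rec 1 2 ≤-refl ≤-refl (s≤s (s≤s z≤n)) ⟩
        2 * f 2 1 3
      ≡⟨ cong (2 *_) (trans (penult-col 1 ≤-refl (s≤s z≤n)) (rows₁ 1)) ⟩
        0
      ∎
      where open ≡-Reasoning

    level-2 : ∀ i k → f 2 i k ≡ M₂ i k
    level-2 0 k = outside 2 0 k (s≤s z≤n) (inj₁ refl)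
    level-2 (suc (suc (suc (suc (suc i))))) k = beyond-row _ k (s≤s (s≤s (s≤s (s≤s (s≤s z≤n)))))
    level-2 1 0 = col-zero 1
    level-2 2 0 = col-zero 2
    level-2 3 0 = col-zero 3
    level-2 4 0 = col-zero 4
    level-2 1 (suc (suc (suc (suc (suc k))))) = beyond-col 1 _ (s≤s (s≤s (s≤s (s≤s (s≤s z≤n)))))
    level-2 2 (suc (suc (suc (suc (suc k))))) = beyond-col 2 _ (s≤s (s≤s (s≤s (s≤s (s≤s z≤n)))))
    level-2 3 (suc (suc (suc (suc (suc k))))) = beyond-col 3 _ (s≤s (s≤s (s≤s (s≤s (s≤s z≤n)))))
    level-2 4 (suc (suc (suc (suc (suc k))))) = beyond-col 4 _ (s≤s (s≤s (s≤s (s≤s (s≤s z≤n)))))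
    level-2 1 1 = diagonal 1 ≤-refl (s≤s z≤n)
    level-2 1 2 = entry-1-2
    level-2 1 3 = trans (penult-col 1 ≤-refl (s≤s z≤n)) (rows₁ 1)
    level-2 1 4 = last-col 1 ≤-refl (s≤s z≤n)
    level-2 2 1 = entry-2-1
    level-2 2 2 = diagonal 2 (s≤s z≤n) (s≤s (s≤s z≤n))
    level-2 2 3 = trans (penult-col 2 (s≤s z≤n) ≤-refl) (rows₁ 2)
    level-2 2 4 = last-col 2 (s≤s z≤n) (s≤s (s≤s z≤n))
    level-2 3 1 = trans (penult-row 1 ≤-refl (s≤s z≤n)) (cong₂ _+_ (rows₁ 1) (cols₁ 1))
    level-2 3 2 = trans (penult-row 2 (s≤s z≤n) ≤-refl) (cong₂ _+_ (rows₁ 2) (cols₁ 2))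
    level-2 3 3 = penult-col-P+1
    level-2 3 4 = penult-row-P+2
    level-2 4 1 = trans (last-row 1 ≤-refl (s≤s z≤n)) (rows₁ 1)
    level-2 4 2 = trans (last-row 2 (s≤s z≤n) ≤-refl) (rows₁ 2)
    level-2 4 3 = penult-col-P+2
    level-2 4 4 = last-row-P+2

    rows₂ : ∀ k → R 2 k ≡ sumTo (M₂ k) 4
    rows₂ k = sumTo-cong _ _ 4 (λ j _ _ → level-2 k j)
    cols₂ : ∀ k → C 2 k ≡ sumTo (λ i → M₂ i k) 4
    cols₂ k = sumTo-cong _ _ 4 (λ i _ _ → level-2 i k)

    within : ∀ {Q : ℕ → Set} → Q 1 → Q 2 → Q 3 → Q 4 → ∀ j → 1 ≤ j → j ≤ 4 → Q j
    within q₁ q₂ q₃ q₄ 1 _ _ = q₁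
    within q₁ q₂ q₃ q₄ 2 _ _ = q₂
    within q₁ q₂ q₃ q₄ 3 _ _ = q₃
    within q₁ q₂ q₃ q₄ 4 _ _ = q₄
    within q₁ q₂ q₃ q₄ (suc (suc (suc (suc (suc j))))) _ (s≤s (s≤s (s≤s (s≤s ()))))

    col1-check : ∀ j → M₂ j 1 ≡ sumTo (M₁ (4 + 1 ∸ j)) 2 → f 2 j 1 ≡ R 1 (4 + 1 ∸ j)
    col1-check j e = trans (level-2 j 1) (trans e (sym (rows₁ _)))
    transpose-check : ∀ k i → M₂ i k ≡ M₂ k i + M₂ (i ∸ k + 1) 1 → f 2 i k ≡ f 2 k i + f 2 (i ∸ k + 1) 1
    transpose-check k i e = trans (level-2 i k) (trans e (sym (cong₂ _+_ (level-2 k i) (level-2 _ 1))))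
    symmetry-check : ∀ i k → M₂ i k ≡ M₂ (4 + 1 ∸ k) (4 + 1 ∸ i) → f 2 i k ≡ f 2 (4 + 1 ∸ k) (4 + 1 ∸ i)
    symmetry-check i k e = trans (level-2 i k) (trans e (sym (level-2 _ _)))
    rowsum-check : ∀ k → Rec (λ r → sumTo (M₂ r) 4) (λ r → sumTo (M₁ r) 2) k → Rec (R 2) (R 1) k
    rowsum-check k = rec-transport {x = λ r → sumTo (M₂ r) 4} {y = R 2} {s = λ r → sumTo (M₁ r) 2} {t = R 1} k
      (sym (rows₂ k)) (sym (rows₂ (k + 1))) (sym (rows₂ (k + 2))) (sym (rows₁ k))
    colsum-check : ∀ k → sumTo (λ i → M₂ i k) 4 ≡ sumTo (M₂ (k + 1)) 4 → C 2 k ≡ R 2 (k + 1)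
    colsum-check k e = trans (cols₂ k) (trans e (sym (rows₂ (k + 1))))

    col1-rowsums-2 : ∀ j → 2 ≤ j → j ≤ 4 → f 2 j 1 ≡ R 1 (4 + 1 ∸ j)
    col1-rowsums-2 j 2≤j j≤4 =
      within {λ j → 2 ≤ j → f 2 j 1 ≡ R 1 (4 + 1 ∸ j)}
        (λ { (s≤s ()) }) (λ _ → col1-check 2 refl) (λ _ → col1-check 3 refl) (λ _ → col1-check 4 refl)
        j (≤-trans (s≤s z≤n) 2≤j) j≤4 2≤j

    Transposed : ℕ → ℕ → Set
    Transposed k i = f 2 i k ≡ f 2 k i + f 2 (i ∸ k + 1) 1

    transpose-2 : ∀ k i → 1 ≤ k → k + 1 ≤ i → i ≤ 4 → Transposed k i
    transpose-2 k i 1≤k k<i i≤4 =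
      within {λ k → ∀ i → k + 1 ≤ i → i ≤ 4 → Transposed k i}
        (λ i k<i i≤4 → within {λ i → 2 ≤ i → Transposed 1 i} (λ { (s≤s ()) }) (λ _ → transpose-check 1 2 refl)
                 (λ _ → transpose-check 1 3 refl) (λ _ → transpose-check 1 4 refl) i (positive {1} k<i) i≤4 k<i)
        (λ i k<i i≤4 → within {λ i → 3 ≤ i → Transposed 2 i} (λ { (s≤s ()) }) (λ { (s≤s (s≤s ())) })
                 (λ _ → transpose-check 2 3 refl) (λ _ → transpose-check 2 4 refl) i (positive {2} k<i) i≤4 k<i)
        (λ i k<i i≤4 → within {λ i → 4 ≤ i → Transposed 3 i} (λ { (s≤s ()) }) (λ { (s≤s (s≤s ())) })
                 (λ { (s≤s (s≤s (s≤s ()))) }) (λ _ → transpose-check 3 4 refl) i (positive {3} k<i) i≤4 k<i)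
        (λ i 5≤i i≤4 → ⊥-elim (<-irrefl refl (≤-trans 5≤i i≤4)))
        k 1≤k (≤-trans (m≤m+n k 1) (≤-trans k<i i≤4)) i k<i i≤4
      where
      positive : ∀ {k i} → k + 1 ≤ i → 1 ≤ i
      positive {k} k<i = ≤-trans (m≤n+m 1 k) k<i

    upper-col-rec-2 : ∀ r c → 1 ≤ r → r + 3 ≤ c → c ≤ 4 → Rec (λ m → f 2 m c) (λ m → f 1 m (c ∸ 2)) r
    upper-col-rec-2 0 c () _ _
    upper-col-rec-2 1 c _ 4≤c c≤4 rewrite ≤-antisym c≤4 4≤c | level-2 3 4 | level-2 1 4 | level-1 1 2 | level-2 2 4 = refl
    upper-col-rec-2 (suc (suc r)) c _ r+3≤c c≤4 =
      ⊥-elim (<-irrefl refl (≤-trans (+-monoˡ-≤ 3 (s≤s (s≤s z≤n))) (≤-trans r+3≤c c≤4)))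

    symmetric-2 : ∀ i k → 1 ≤ i → i ≤ 4 → 1 ≤ k → k ≤ 4 → f 2 i k ≡ f 2 (4 + 1 ∸ k) (4 + 1 ∸ i)
    symmetric-2 i k 1≤i i≤4 1≤k k≤4 =
      within {λ i → ∀ k → 1 ≤ k → k ≤ 4 → f 2 i k ≡ f 2 (4 + 1 ∸ k) (4 + 1 ∸ i)}
        (within (symmetry-check 1 1 refl) (symmetry-check 1 2 refl) (symmetry-check 1 3 refl) (symmetry-check 1 4 refl))
        (within (symmetry-check 2 1 refl) (symmetry-check 2 2 refl) (symmetry-check 2 3 refl) (symmetry-check 2 4 refl))
        (within (symmetry-check 3 1 refl) (symmetry-check 3 2 refl) (symmetry-check 3 3 refl) (symmetry-check 3 4 refl))
        (within (symmetry-check 4 1 refl) (symmetry-check 4 2 refl) (symmetry-check 4 3 refl) (symmetry-check 4 4 refl))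
        i 1≤i i≤4 k 1≤k k≤4

    rowsum-rec-2 : ∀ k → 1 ≤ k → k + 1 ≤ 4 → Rec (R 2) (R 1) k
    rowsum-rec-2 k 1≤k k+1≤4 =
      within {λ k → k + 1 ≤ 4 → Rec (R 2) (R 1) k}
        (λ _ → rowsum-check 1 refl) (λ _ → rowsum-check 2 refl) (λ _ → rowsum-check 3 refl)
        (λ { (s≤s (s≤s (s≤s (s≤s ())))) }) k 1≤k (≤-trans (m≤m+n k 1) k+1≤4) k+1≤4

    invariant-2 : Invariant 2 4
    invariant-2 = record
      { row1-zero       = level-2 1
      ; col1-rowsums    = col1-rowsums-2
      ; lower-transpose = transpose-2
      ; upper-col-rec   = upper-col-rec-2
      ; symmetric       = symmetric-2
      ; rowsum-rec      = rowsum-rec-2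
      ; colsum-shift    = within (colsum-check 1 refl) (colsum-check 2 refl) (colsum-check 3 refl) (colsum-check 4 refl)
      }

  invariant : ∀ n → 2 ≤ n → Invariant n (2 * n)
  invariant 1 (s≤s ())
  invariant 2 _ = LevelTwo.invariant-2
  invariant (suc (suc (suc t))) _ = Step.step (suc t) (s≤s z≤n) (invariant (suc (suc t)) (s≤s (s≤s z≤n)))

theorem1p2 : (f : ℕ → ℕ → ℕ → ℕ) → IsDelta f →
    ∀ n → 1 ≤ n → ∀ m k → 1 ≤ m → m ≤ 2 * n → 1 ≤ k → k ≤ 2 * n →
    f n m k ≡ f n (2 * n + 1 ∸ k) (2 * n + 1 ∸ m)
theorem1p2 f D 1 _ = Delta.symmetric-level-1 f D
theorem1p2 f D (suc (suc t)) _ = Invariant.symmetric (invariant (suc (suc t)) (s≤s (s≤s z≤n)))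
  where open Delta f D
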